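{- Let $t\ge2$ be an integer and let $A$ be a $(2t+2)$-compact set. Then \[ -\prod_{a\in A,\ a>0}\left(1-\left(\frac{2t+2}{a} \right)^2\right) = \prod_{a \in \max_{2t+2}(A)} \frac{a+2t+2}{a}. \]
   Context: A finite set of integers $A$ is $(2t+2)$-compact if: (i) $-1,-2,\ldots,-2t-1\in A$; (ii) every $a\in A$ other than $-1,\dots,-2t-1$ satisfies $a\ge1$ and $a\not\equiv0 \pmod{2t+2}$; (iii) whenever $b>a\ge1$ are integers with $a\equiv b\pmod{2t+2}$ and $b\in A$, then $a\in A$. An element $a\in A$ is $(2t+2)$-maximal if no $b\in A$ with $b>a$ satisfies $b\equiv a\pmod{2t+2}$; $\max_{2t+2}(A)$ is the set of $(2t+2)$-maximal elements of $A$. -}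

module Defs where

open import Data.Nat as ℕ using (ℕ)
open import Data.Integer as ℤ using (ℤ; +_; -[1+_]; +0)
open import Data.Integer.Divisibility using (_∣_)
open import Data.Rational as ℚ using (ℚ)
open import Data.List using (List; foldr)
open import Data.List.Membership.Propositional using (_∈_)
open import Data.Product using (_×_; ∃)
open import Relation.Nullary using (¬_)
open import Relation.Binary.PropositionalEquality using (_≡_)

modulus : ℕ → ℤ
modulus t = + (2 ℕ.* t ℕ.+ 2)

_≡_[mod_] : ℤ → ℤ → ℤ → Set
a ≡ b [mod m ] = m ∣ (b ℤ.- a)

-- the rational number p / q for integers p, q with q ≠ 0
-- (q = 0 is given the junk value 0; it never occurs in the statement)
ratio : ℤ → ℤ → ℚ
ratio p (+ 0)      = ℚ.0ℚ
ratio p (+ ℕ.suc n) = p ℚ./ ℕ.suc n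
ratio p -[1+ n ]   = (ℤ.- p) ℚ./ ℕ.suc n

prodℚ : List ℚ → ℚ
prodℚ = foldr ℚ._*_ ℚ.1ℚ

IsSpecialNeg : ℕ → ℤ → Set
IsSpecialNeg t a = ∃ λ i → 1 ℕ.≤ i × i ℕ.≤ 2 ℕ.* t ℕ.+ 1 × a ≡ ℤ.- (+ i)

-- (2t+2)-compactness of a finite set A (given as a duplicate-free list)
record Compact (t : ℕ) (A : List ℤ) : Set where
  field
    negatives : ∀ i → 1 ℕ.≤ i → i ℕ.≤ 2 ℕ.* t ℕ.+ 1 → ℤ.- (+ i) ∈ A
    others    : ∀ a → a ∈ A → ¬ IsSpecialNeg t a →
                (+ 1 ℤ.≤ a) × ¬ (modulus t ∣ a)
    downward  : ∀ a b → a ℤ.< b → + 1 ℤ.≤ a → a ≡ b [mod modulus t ] →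
                b ∈ A → a ∈ A

IsMaximal : ℕ → List ℤ → ℤ → Set
IsMaximal t A a = a ∈ A × (∀ b → b ∈ A → a ℤ.< b → ¬ (a ≡ b [mod modulus t ]))

-- Induction on the number of positive elements of A, with m = 2t+2.  If there are none, A and
-- its set of maxima are both {-1, …, -(2t+1)}, and ∏ (a + m)/a over this set is -1: the
-- numerators are the negated images of the denominators under the involution a ↦ -m - a,
-- and there is an odd number of them.  Otherwise remove the largest positive element x.
-- The rest is still compact, x - m lies in A, and the maxima change only by x being replaced
-- by x - m.  Since (1 - (m/x)²) · x/(x - m) = (x + m)/x, both sides are multiplied by the
-- same factor 1 - (m/x)².

module Submission where

open import Defs

open import Algebra.Bundles using (CommutativeMonoid)
open import Data.Empty using (⊥-elim)
open import Data.Integer as ℤ using (ℤ; +_; +0; -[1+_]; +[1+_])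
open import Data.Integer.Divisibility using (_∣_)
import Data.Integer.Divisibility.Signed as DS
import Data.Integer.Properties as ℤP
open import Data.Integer.Tactic.RingSolver using (solve-∀)
open import Data.List using (List; []; _∷_; foldr; map; length; filter)
open import Data.List.Extrema ℤP.≤-totalOrder using (max; argmax-sel; ⊥≤max; xs≤max)
open import Data.List.Membership.DecPropositional ℤ._≟_ using (_∈?_)
open import Data.List.Membership.Propositional using (_∈_)
open import Data.List.Membership.Propositional.Properties
  using (∈-map⁺; ∈-map⁻; ∈-filter⁺; ∈-filter⁻)
open import Data.List.Membership.Propositional.Properties.WithK using (unique∧set⇒bag)
import Data.List.Properties as List
open import Data.List.Relation.Binary.BagAndSetEquality using (∼bag⇒↭)
open import Data.List.Relation.Binary.Permutation.Propositional
  using (_↭_; ↭-trans; ↭-reflexive; ↭⇒↭ₛ)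
import Data.List.Relation.Binary.Permutation.Propositional.Properties as ↭ₚ
open import Data.List.Relation.Binary.Permutation.Setoid.Properties using (foldr-commMonoid)
open import Data.List.Relation.Unary.All as All using (All; []; _∷_)
import Data.List.Relation.Unary.All.Properties as AllP
open import Data.List.Relation.Unary.Any using (here; there)
open import Data.List.Relation.Unary.Unique.Propositional using (Unique; []; _∷_)
import Data.List.Relation.Unary.Unique.Propositional.Properties as Unique
open import Data.Nat as ℕ using (ℕ; zero; suc)
import Data.Nat.Divisibility as ℕD
import Data.Nat.Properties as ℕP
open import Data.Product using (_×_; _,_; ∃; proj₁; proj₂)
open import Data.Rational as ℚ using (ℚ)
import Data.Rational.Properties as ℚP
open import Data.Rational.Unnormalised as ℚᵘ using (ℚᵘ; mkℚᵘ; *≡*)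
import Data.Rational.Unnormalised.Properties as ℚᵘP
open import Data.Sum using ([_,_]′)
open import Function using (case_of_; id; _∘_; _⇔_; mk⇔; Equivalence)
import Function.Properties.Equivalence as ⇔
open import Relation.Binary.Core using (_Preserves_⟶_)
open import Relation.Binary.Definitions using (tri<; tri≈; tri>)
open import Relation.Binary.PropositionalEquality
open import Relation.Nullary using (¬_; Dec; yes; no; ¬?)
import Relation.Nullary.Decidable as Dec

ratioᵘ : ℤ → ℤ → ℚᵘ
ratioᵘ p +0       = ℚᵘ.0ℚᵘ
ratioᵘ p +[1+ n ] = mkℚᵘ p n
ratioᵘ p -[1+ n ] = mkℚᵘ (ℤ.- p) n

toℚᵘ-ratio : ∀ p q → ℚ.toℚᵘ (ratio p q) ℚᵘ.≃ ratioᵘ p q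
toℚᵘ-ratio p +0       = *≡* refl
toℚᵘ-ratio p +[1+ n ] = ℚP.toℚᵘ-fromℚᵘ (mkℚᵘ p n)
toℚᵘ-ratio p -[1+ n ] = ℚP.toℚᵘ-fromℚᵘ (mkℚᵘ (ℤ.- p) n)

ratio-≃ᵘ : ∀ {p q r s} → ratioᵘ p q ℚᵘ.≃ ratioᵘ r s → ratio p q ≡ ratio r s
ratio-≃ᵘ {p} {q} {r} {s} eq = ℚP.toℚᵘ-injective (begin
  ℚ.toℚᵘ (ratio p q)  ≈⟨ toℚᵘ-ratio p q ⟩
  ratioᵘ p q          ≈⟨ eq ⟩
  ratioᵘ r s          ≈⟨ toℚᵘ-ratio r s ⟨
  ℚ.toℚᵘ (ratio r s)  ∎)
  where open ℚᵘP.≃-Reasoning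

-x*y≡x*-y : ∀ x y → ℤ.- x ℤ.* y ≡ x ℤ.* ℤ.- y
-x*y≡x*-y x y = trans (sym (ℤP.neg-distribˡ-* x y)) (ℤP.neg-distribʳ-* x y)

move-neg : ∀ {x y u v} → x ℤ.* ℤ.- y ≡ u ℤ.* v → x ℤ.* y ≡ ℤ.- u ℤ.* v
move-neg {x} {y} {u} {v} eq = ℤP.neg-injective (begin
  ℤ.- (x ℤ.* y)        ≡⟨ ℤP.neg-distribʳ-* x y ⟩
  x ℤ.* ℤ.- y          ≡⟨ eq ⟩
  u ℤ.* v              ≡⟨ ℤP.neg-involutive _ ⟨
  ℤ.- ℤ.- (u ℤ.* v)    ≡⟨ cong ℤ.-_ (ℤP.neg-distribˡ-* u v) ⟩
  ℤ.- (ℤ.- u ℤ.* v)    ∎)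
  where open ≡-Reasoning

ratio-cross : ∀ p r {q s} → q ≢ +0 → s ≢ +0 → p ℤ.* s ≡ r ℤ.* q → ratio p q ≡ ratio r s
ratio-cross p r {q} {s} q≢0 s≢0 eq = ratio-≃ᵘ {p} {q} {r} {s} (*≡* (cross q s q≢0 s≢0 eq))
  where
  cross : ∀ q s → q ≢ +0 → s ≢ +0 → p ℤ.* s ≡ r ℤ.* q →
          ℚᵘ.↥ ratioᵘ p q ℤ.* ℚᵘ.↧ ratioᵘ r s ≡ ℚᵘ.↥ ratioᵘ r s ℤ.* ℚᵘ.↧ ratioᵘ p q
  cross +0       _        q≢0 _   _ = ⊥-elim (q≢0 refl)
  cross _        +0       _   s≢0 _ = ⊥-elim (s≢0 refl)
  cross +[1+ a ] +[1+ b ] _   _   e = e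
  cross +[1+ a ] -[1+ b ] _   _   e = move-neg {p} {+[1+ b ]} {r} {+[1+ a ]} e
  cross -[1+ a ] +[1+ b ] _   _   e = sym (move-neg {r} {+[1+ a ]} {p} {+[1+ b ]} (sym e))
  cross -[1+ a ] -[1+ b ] _   _   e = trans (-x*y≡x*-y p +[1+ b ]) (trans e (sym (-x*y≡x*-y r +[1+ a ])))

ratio-* : ∀ p r {q s} → q ≢ +0 → s ≢ +0 →
          ratio p q ℚ.* ratio r s ≡ ratio (p ℤ.* r) (q ℤ.* s)
ratio-* p r {q} {s} q≢0 s≢0 = ℚP.toℚᵘ-injective (begin
  ℚ.toℚᵘ (ratio p q ℚ.* ratio r s)
    ≈⟨ ℚP.toℚᵘ-homo-* (ratio p q) (ratio r s) ⟩
  ℚ.toℚᵘ (ratio p q) ℚᵘ.* ℚ.toℚᵘ (ratio r s)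
    ≈⟨ ℚᵘP.*-cong (toℚᵘ-ratio p q) (toℚᵘ-ratio r s) ⟩
  ratioᵘ p q ℚᵘ.* ratioᵘ r s
    ≈⟨ ratioᵘ-* q s q≢0 s≢0 ⟩
  ratioᵘ (p ℤ.* r) (q ℤ.* s)
    ≈⟨ toℚᵘ-ratio (p ℤ.* r) (q ℤ.* s) ⟨
  ℚ.toℚᵘ (ratio (p ℤ.* r) (q ℤ.* s))
    ∎)
  where
  open ℚᵘP.≃-Reasoning
  numerator-cong : ∀ {x y} n → x ≡ y → mkℚᵘ x n ℚᵘ.≃ mkℚᵘ y n
  numerator-cong n eq = *≡* (cong (ℤ._* +[1+ n ]) eq)
  ratioᵘ-* : ∀ q s → q ≢ +0 → s ≢ +0 →
             ratioᵘ p q ℚᵘ.* ratioᵘ r s ℚᵘ.≃ ratioᵘ (p ℤ.* r) (q ℤ.* s)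
  ratioᵘ-* +0       _        q≢0 _   = ⊥-elim (q≢0 refl)
  ratioᵘ-* _        +0       _   s≢0 = ⊥-elim (s≢0 refl)
  ratioᵘ-* +[1+ a ] +[1+ b ] _   _   = ℚᵘP.≃-refl
  ratioᵘ-* +[1+ a ] -[1+ b ] _   _   = numerator-cong _ (sym (ℤP.neg-distribʳ-* p r))
  ratioᵘ-* -[1+ a ] +[1+ b ] _   _   = numerator-cong _ (sym (ℤP.neg-distribˡ-* p r))
  ratioᵘ-* -[1+ a ] -[1+ b ] _   _   =
    numerator-cong _ (trans (-x*y≡x*-y p (ℤ.- r)) (cong (p ℤ.*_) (ℤP.neg-involutive r)))

1-ratio : ∀ p n → ℚ.1ℚ ℚ.- ratio p +[1+ n ] ≡ ratio (+[1+ n ] ℤ.- p) +[1+ n ]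
1-ratio p n = ℚP.toℚᵘ-injective (begin
  ℚ.toℚᵘ (ℚ.1ℚ ℚ.- ratio p +[1+ n ])
    ≈⟨ ℚP.toℚᵘ-homo-+ ℚ.1ℚ (ℚ.- ratio p +[1+ n ]) ⟩
  ℚᵘ.1ℚᵘ ℚᵘ.+ ℚ.toℚᵘ (ℚ.- ratio p +[1+ n ])
    ≈⟨ ℚᵘP.+-congʳ ℚᵘ.1ℚᵘ (ℚP.toℚᵘ-homo‿- (ratio p +[1+ n ])) ⟩
  ℚᵘ.1ℚᵘ ℚᵘ.- ℚ.toℚᵘ (ratio p +[1+ n ])
    ≈⟨ ℚᵘP.+-congʳ ℚᵘ.1ℚᵘ (ℚᵘP.-‿cong (toℚᵘ-ratio p +[1+ n ])) ⟩
  ℚᵘ.1ℚᵘ ℚᵘ.- mkℚᵘ p n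
    ≈⟨ *≡* cross ⟩
  mkℚᵘ (+[1+ n ] ℤ.- p) n
    ≈⟨ toℚᵘ-ratio (+[1+ n ] ℤ.- p) +[1+ n ] ⟨
  ℚ.toℚᵘ (ratio (+[1+ n ] ℤ.- p) +[1+ n ])
    ∎)
  where
  open ℚᵘP.≃-Reasoning
  cross : (+ 1 ℤ.* +[1+ n ] ℤ.+ ℤ.- p ℤ.* + 1) ℤ.* +[1+ n ]
          ≡ (+[1+ n ] ℤ.- p) ℤ.* +[1+ n ℕ.+ 0 ]
  cross = trans (cross-ℤ +[1+ n ] p)
                (cong (λ k → (+[1+ n ] ℤ.- p) ℤ.* +[1+ k ]) (sym (ℕP.+-identityʳ n)))
    where
    cross-ℤ : ∀ b x → (+ 1 ℤ.* b ℤ.+ ℤ.- x ℤ.* + 1) ℤ.* b ≡ (b ℤ.- x) ℤ.* b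
    cross-ℤ = solve-∀

*-≢0 : ∀ {x y} → x ≢ +0 → y ≢ +0 → x ℤ.* y ≢ +0
*-≢0 {x} x≢0 y≢0 xy≡0 = [ x≢0 , y≢0 ]′ (ℤP.i*j≡0⇒i≡0∨j≡0 x xy≡0)

positiveFactor : ℤ → ℤ → ℚ
positiveFactor m a = ℚ.1ℚ ℚ.- ratio m a ℚ.* ratio m a

maximalFactor : ℤ → ℤ → ℚ
maximalFactor m a = ratio (a ℤ.+ m) a

positiveFactor-telescopes : ∀ n m → +[1+ n ] ℤ.- m ≢ +0 →
  positiveFactor m +[1+ n ] ℚ.* maximalFactor m (+[1+ n ] ℤ.- m) ≡ maximalFactor m +[1+ n ]
positiveFactor-telescopes n m y≢0 = begin
  (ℚ.1ℚ ℚ.- ratio m x ℚ.* ratio m x) ℚ.* ratio (y ℤ.+ m) y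
    ≡⟨ cong (λ z → (ℚ.1ℚ ℚ.- z) ℚ.* ratio (y ℤ.+ m) y) (ratio-* m m x≢0 x≢0) ⟩
  (ℚ.1ℚ ℚ.- ratio (m ℤ.* m) (x ℤ.* x)) ℚ.* ratio (y ℤ.+ m) y
    ≡⟨ cong (ℚ._* ratio (y ℤ.+ m) y) (1-ratio (m ℤ.* m) _) ⟩
  ratio (x ℤ.* x ℤ.- m ℤ.* m) (x ℤ.* x) ℚ.* ratio (y ℤ.+ m) y
    ≡⟨ ratio-* (x ℤ.* x ℤ.- m ℤ.* m) (y ℤ.+ m) (*-≢0 x≢0 x≢0) y≢0 ⟩
  ratio ((x ℤ.* x ℤ.- m ℤ.* m) ℤ.* (y ℤ.+ m)) (x ℤ.* x ℤ.* y)
    ≡⟨ ratio-cross _ (x ℤ.+ m) (*-≢0 (*-≢0 x≢0 x≢0) y≢0) x≢0 (cross x m) ⟩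
  ratio (x ℤ.+ m) x
    ∎
  where
  open ≡-Reasoning
  x = +[1+ n ]
  y = x ℤ.- m
  x≢0 : x ≢ +0
  x≢0 ()
  cross : ∀ x m → (x ℤ.* x ℤ.- m ℤ.* m) ℤ.* (x ℤ.- m ℤ.+ m) ℤ.* x
                  ≡ (x ℤ.+ m) ℤ.* (x ℤ.* x ℤ.* (x ℤ.- m))
  cross = solve-∀

prodℤ : List ℤ → ℤ
prodℤ = foldr ℤ._*_ (+ 1)

prodℤ-↭ : prodℤ Preserves _↭_ ⟶ _≡_
prodℤ-↭ p = foldr-commMonoid M.setoid M.isCommutativeMonoid (↭⇒↭ₛ p)
  where module M = CommutativeMonoid ℤP.*-1-commutativeMonoid

prodℚ-↭ : prodℚ Preserves _↭_ ⟶ _≡_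
prodℚ-↭ p = foldr-commMonoid M.setoid M.isCommutativeMonoid (↭⇒↭ₛ p)
  where module M = CommutativeMonoid ℚP.*-1-commutativeMonoid

prodℤ-≢0 : ∀ {xs} → All (_≢ +0) xs → prodℤ xs ≢ +0
prodℤ-≢0 []           ()
prodℤ-≢0 (x≢0 ∷ xs≢0) = *-≢0 x≢0 (prodℤ-≢0 xs≢0)

prodℚ-map-ratio : ∀ (num den : ℤ → ℤ) xs → All (λ a → den a ≢ +0) xs →
  prodℚ (map (λ a → ratio (num a) (den a)) xs) ≡ ratio (prodℤ (map num xs)) (prodℤ (map den xs))
prodℚ-map-ratio num den []       []           = refl
prodℚ-map-ratio num den (x ∷ xs) (dx≢0 ∷ ds≢0) = begin
  ratio (num x) (den x) ℚ.* prodℚ (map (λ a → ratio (num a) (den a)) xs)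
    ≡⟨ cong (ratio (num x) (den x) ℚ.*_) (prodℚ-map-ratio num den xs ds≢0) ⟩
  ratio (num x) (den x) ℚ.* ratio (prodℤ (map num xs)) (prodℤ (map den xs))
    ≡⟨ ratio-* (num x) _ dx≢0 (prodℤ-≢0 (AllP.map⁺ ds≢0)) ⟩
  ratio (prodℤ (map num (x ∷ xs))) (prodℤ (map den (x ∷ xs)))
    ∎
  where open ≡-Reasoning

prodℤ-map-neg : ∀ xs → prodℤ (map ℤ.-_ xs) ≡ ℤ.-1ℤ ℤ.^ length xs ℤ.* prodℤ xs
prodℤ-map-neg []       = refl
prodℤ-map-neg (x ∷ xs) = begin
  ℤ.- x ℤ.* prodℤ (map ℤ.-_ xs)
    ≡⟨ cong (ℤ.- x ℤ.*_) (prodℤ-map-neg xs) ⟩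
  ℤ.- x ℤ.* (ℤ.-1ℤ ℤ.^ length xs ℤ.* prodℤ xs)
    ≡⟨ rearrange x (ℤ.-1ℤ ℤ.^ length xs) (prodℤ xs) ⟩
  ℤ.-1ℤ ℤ.* ℤ.-1ℤ ℤ.^ length xs ℤ.* (x ℤ.* prodℤ xs)
    ∎
  where
  open ≡-Reasoning
  rearrange : ∀ x s p → ℤ.- x ℤ.* (s ℤ.* p) ≡ ℤ.- + 1 ℤ.* s ℤ.* (x ℤ.* p)
  rearrange = solve-∀

-1^odd : ∀ t → ℤ.-1ℤ ℤ.^ (2 ℕ.* t ℕ.+ 1) ≡ ℤ.-1ℤ
-1^odd t = begin
  ℤ.-1ℤ ℤ.^ (2 ℕ.* t ℕ.+ 1)                  ≡⟨ ℤP.^-distribˡ-+-* ℤ.-1ℤ (2 ℕ.* t) 1 ⟩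
  ℤ.-1ℤ ℤ.^ (2 ℕ.* t) ℤ.* ℤ.-1ℤ              ≡⟨ cong (ℤ._* ℤ.-1ℤ) (ℤP.^-*-assoc ℤ.-1ℤ 2 t) ⟨
  (ℤ.-1ℤ ℤ.^ 2) ℤ.^ t ℤ.* ℤ.-1ℤ              ≡⟨ cong (ℤ._* ℤ.-1ℤ) (ℤP.^-zeroˡ t) ⟩
  ℤ.-1ℤ                                      ∎
  where open ≡-Reasoning

unique-⇔⇒↭ : {A : Set} {xs ys : List A} → Unique xs → Unique ys →
             (∀ {x} → x ∈ xs ⇔ x ∈ ys) → xs ↭ ys
unique-⇔⇒↭ xs! ys! xs⇔ys = ∼bag⇒↭ (unique∧set⇒bag xs! ys! xs⇔ys)

involution-↭ : {A : Set} {f : A → A} {xs : List A} → (∀ x → f (f x) ≡ x) →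
               (∀ {x} → x ∈ xs → f x ∈ xs) → Unique xs → map f xs ↭ xs
involution-↭ {f = f} {xs} ff≡id f∈ xs! =
  unique-⇔⇒↭ (Unique.map⁺ f-injective xs!) xs! (mk⇔ to from)
  where
  f-injective : ∀ {x y} → f x ≡ f y → x ≡ y
  f-injective {x} {y} fx≡fy = trans (sym (ff≡id x)) (trans (cong f fx≡fy) (ff≡id y))
  to : ∀ {y} → y ∈ map f xs → y ∈ xs
  to y∈ with _ , x∈ , refl ← ∈-map⁻ f y∈ = f∈ x∈
  from : ∀ {y} → y ∈ xs → y ∈ map f xs
  from {y} y∈ = subst (_∈ map f xs) (ff≡id y) (∈-map⁺ f (f∈ y∈))

negRange : ℕ → List ℤ
negRange zero    = []
negRange (suc n) = -[1+ n ] ∷ negRange n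

negRange-length : ∀ n → length (negRange n) ≡ n
negRange-length zero    = refl
negRange-length (suc n) = cong suc (negRange-length n)

∈-negRange⁻ : ∀ {a} n → a ∈ negRange n → ∃ λ i → 1 ℕ.≤ i × i ℕ.≤ n × a ≡ ℤ.- (+ i)
∈-negRange⁻ (suc n) (here refl) = suc n , ℕ.s≤s ℕ.z≤n , ℕP.≤-refl , refl
∈-negRange⁻ (suc n) (there a∈) with i , 1≤i , i≤n , refl ← ∈-negRange⁻ n a∈ =
  i , 1≤i , ℕP.m≤n⇒m≤1+n i≤n , refl

∈-negRange⁺ : ∀ {i} n → 1 ℕ.≤ i → i ℕ.≤ n → ℤ.- (+ i) ∈ negRange n
∈-negRange⁺ {suc i} (suc n) 1≤i i≤n with i ℕ.≟ n
... | yes refl = here refl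
... | no  i≢n  = there (∈-negRange⁺ n 1≤i (ℕP.≤∧≢⇒< (ℕ.s≤s⁻¹ i≤n) i≢n))

negRange-unique : ∀ n → Unique (negRange n)
negRange-unique zero    = []
negRange-unique (suc n) = All.tabulate (λ a∈ → -[1+n]∉ a∈ ∘ sym) ∷ negRange-unique n
  where
  -[1+n]∉ : ∀ {a} → a ∈ negRange n → a ≢ -[1+ n ]
  -[1+n]∉ a∈ a≡ with suc i , _ , i<n , refl ← ∈-negRange⁻ n a∈ with refl ← a≡ =
    ℕP.<-irrefl refl i<n

negRange-≢0 : ∀ n → All (_≢ +0) (negRange n)
negRange-≢0 zero    = []
negRange-≢0 (suc n) = (λ ()) ∷ negRange-≢0 n

module _ (n : ℕ) where

  reflect : ℤ → ℤ
  reflect a = ℤ.- (a ℤ.+ +[1+ n ])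

  reflect-involutive : ∀ a → reflect (reflect a) ≡ a
  reflect-involutive a = cancel a +[1+ n ]
    where
    cancel : ∀ a m → ℤ.- (ℤ.- (a ℤ.+ m) ℤ.+ m) ≡ a
    cancel = solve-∀

  reflect-negRange : ∀ {a} → a ∈ negRange n → reflect a ∈ negRange n
  reflect-negRange a∈ with suc j , _ , j<n , refl ← ∈-negRange⁻ n a∈ =
    subst (_∈ negRange n) (sym reflect≡) (∈-negRange⁺ n (ℕP.m<n⇒0<n∸m j<n) (ℕP.m∸n≤m n j))
    where
    reflect≡ : reflect (ℤ.- (+ suc j)) ≡ ℤ.- (+ (n ℕ.∸ j))
    reflect≡ = cong ℤ.-_ (trans (ℤP.-m+n≡n⊖m (suc j) (suc n))
                               (ℤP.≤-⊖ (ℕ.s≤s (ℕP.<⇒≤ j<n))))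

  prodℚ-negRange : prodℚ (map (maximalFactor +[1+ n ]) (negRange n)) ≡ ratio (ℤ.-1ℤ ℤ.^ n) (+ 1)
  prodℚ-negRange = begin
    prodℚ (map (maximalFactor +[1+ n ]) (negRange n))
      ≡⟨ prodℚ-map-ratio (ℤ._+ +[1+ n ]) id (negRange n) (negRange-≢0 n) ⟩
    ratio (prodℤ (map (ℤ._+ +[1+ n ]) (negRange n))) (prodℤ (map id (negRange n)))
      ≡⟨ cong₂ ratio numerator≡ (cong prodℤ (List.map-id (negRange n))) ⟩
    ratio (ℤ.-1ℤ ℤ.^ n ℤ.* P) P
      ≡⟨ ratio-cross _ (ℤ.-1ℤ ℤ.^ n) {s = + 1} P≢0 (λ ()) (ℤP.*-identityʳ _) ⟩
    ratio (ℤ.-1ℤ ℤ.^ n) (+ 1)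
      ∎
    where
    open ≡-Reasoning
    P = prodℤ (negRange n)
    P≢0 : P ≢ +0
    P≢0 = prodℤ-≢0 (negRange-≢0 n)
    numerator≡ : prodℤ (map (ℤ._+ +[1+ n ]) (negRange n)) ≡ ℤ.-1ℤ ℤ.^ n ℤ.* P
    numerator≡ = begin
      prodℤ (map (ℤ._+ +[1+ n ]) (negRange n))
        ≡⟨ cong prodℤ (List.map-cong (λ a → sym (ℤP.neg-involutive _)) (negRange n)) ⟩
      prodℤ (map (ℤ.-_ ∘ reflect) (negRange n))
        ≡⟨ cong prodℤ (List.map-∘ (negRange n)) ⟩
      prodℤ (map ℤ.-_ (map reflect (negRange n)))
        ≡⟨ prodℤ-map-neg (map reflect (negRange n)) ⟩
      ℤ.-1ℤ ℤ.^ length (map reflect (negRange n)) ℤ.* prodℤ (map reflect (negRange n))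
        ≡⟨ cong₂ (λ k z → ℤ.-1ℤ ℤ.^ k ℤ.* z)
                 (trans (List.length-map reflect (negRange n)) (negRange-length n))
                 (prodℤ-↭ (involution-↭ reflect-involutive reflect-negRange (negRange-unique n))) ⟩
      ℤ.-1ℤ ℤ.^ n ℤ.* P
        ∎

_∖_ : List ℤ → ℤ → List ℤ
xs ∖ x = filter (λ y → ¬? (y ℤ.≟ x)) xs

∈-∖⁻ : ∀ {x y} xs → y ∈ xs ∖ x → y ∈ xs × y ≢ x
∈-∖⁻ {x} xs = ∈-filter⁻ (λ y → ¬? (y ℤ.≟ x)) {xs = xs}

∈-∖⁺ : ∀ {x y xs} → y ∈ xs → y ≢ x → y ∈ xs ∖ x
∈-∖⁺ {x} = ∈-filter⁺ (λ y → ¬? (y ℤ.≟ x))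

∖-unique : ∀ {x xs} → Unique xs → Unique (xs ∖ x)
∖-unique {x} = Unique.filter⁺ (λ y → ¬? (y ℤ.≟ x))

↭-∷-∖ : ∀ {x xs} → Unique xs → x ∈ xs → xs ↭ x ∷ xs ∖ x
↭-∷-∖ {x} {xs} xs! x∈ =
  unique-⇔⇒↭ xs! (All.tabulate (λ y∈ → proj₂ (∈-∖⁻ xs y∈) ∘ sym) ∷ ∖-unique xs!) (mk⇔ to from)
  where
  to : ∀ {y} → y ∈ xs → y ∈ x ∷ xs ∖ x
  to {y} y∈ with y ℤ.≟ x
  ... | yes refl = here refl
  ... | no  y≢x  = there (∈-∖⁺ y∈ y≢x)
  from : ∀ {y} → y ∈ x ∷ xs ∖ x → y ∈ xs
  from (here refl) = x∈
  from (there y∈)  = proj₁ (∈-∖⁻ xs y∈)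

prodℚ-map-∖ : ∀ (h : ℤ → ℚ) {x xs} → Unique xs → x ∈ xs →
              prodℚ (map h xs) ≡ h x ℚ.* prodℚ (map h (xs ∖ x))
prodℚ-map-∖ h xs! x∈ = prodℚ-↭ (↭ₚ.map⁺ h (↭-∷-∖ xs! x∈))

length≡0⇒≡[] : ∀ {A : Set} {xs : List A} → length xs ≡ 0 → xs ≡ []
length≡0⇒≡[] {xs = []} _ = refl

maximum : ∀ {xs} → xs ≢ [] → ∃ λ X → X ∈ xs × All (ℤ._≤ X) xs
maximum {[]}     []≢[] = ⊥-elim ([]≢[] refl)
maximum {y ∷ ys} _     =
  max y ys , [ here , there ]′ (argmax-sel id y ys) , ⊥≤max y ys ∷ xs≤max y ys

congruent-gap : ∀ k {a b} → a ℤ.< b → a ≡ b [mod + k ] → a ℤ.+ + k ℤ.≤ b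
congruent-gap k {a} {b} a<b k∣b-a = begin
  a ℤ.+ + k               ≤⟨ ℤP.+-monoʳ-≤ a (ℤ.+≤+ k≤∣b-a∣) ⟩
  a ℤ.+ + ℤ.∣ b ℤ.- a ∣   ≡⟨ cong (λ d → a ℤ.+ d) (ℤP.0≤i⇒+∣i∣≡i 0≤b-a) ⟩
  a ℤ.+ (b ℤ.- a)         ≡⟨ a+[b-a]≡b a b ⟩
  b                       ∎
  where
  open ℤP.≤-Reasoning
  a+[b-a]≡b : ∀ a b → a ℤ.+ (b ℤ.- a) ≡ b
  a+[b-a]≡b = solve-∀
  0≤b-a : +0 ℤ.≤ b ℤ.- a
  0≤b-a = ℤP.i≤j⇒0≤j-i (ℤP.<⇒≤ a<b)
  ∣b-a∣≢0 : ℤ.∣ b ℤ.- a ∣ ≢ 0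
  ∣b-a∣≢0 eq = ℤP.<⇒≢ a<b (sym (ℤP.i-j≡0⇒i≡j b a (ℤP.∣i∣≡0⇒i≡0 eq)))
  k≤∣b-a∣ : k ℕ.≤ ℤ.∣ b ℤ.- a ∣
  k≤∣b-a∣ = ℕD.∣⇒≤ {{ℕ.≢-nonZero ∣b-a∣≢0}} k∣b-a

≡[mod]-shift : ∀ {a b k} → a ≡ b [mod k ] → a ≡ b ℤ.- k [mod k ]
≡[mod]-shift {a} {b} {k} k∣b-a =
  subst (k ∣_) (swap b a k)
        (DS.∣⇒∣ᵤ {k} (DS.∣m∣n⇒∣m-n (DS.∣ᵤ⇒∣ {k} {b ℤ.- a} k∣b-a) (DS.∣-refl {k})))
  where
  swap : ∀ b a k → b ℤ.- a ℤ.- k ≡ b ℤ.- k ℤ.- a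
  swap = solve-∀

x-k≡x : ∀ x k → (x ℤ.- k) ≡ x [mod k ]
x-k≡x x k = subst (k ∣_) (sym (cancel x k)) (DS.∣⇒∣ᵤ (DS.∣-refl {k}))
  where
  cancel : ∀ x k → x ℤ.- (x ℤ.- k) ≡ k
  cancel = solve-∀

i-j<i : ∀ i {j} → +0 ℤ.< j → i ℤ.- j ℤ.< i
i-j<i i 0<j = subst (i ℤ.- _ ℤ.<_) (ℤP.+-identityʳ i) (ℤP.+-monoʳ-< i (ℤP.neg-mono-< 0<j))

i+k≤j⇒i≤j-k : ∀ {i j} k → i ℤ.+ k ℤ.≤ j → i ℤ.≤ j ℤ.- k
i+k≤j⇒i≤j-k {i} {j} k i+k≤j =
  subst (ℤ._≤ j ℤ.- k) (cancel i k) (ℤP.+-monoˡ-≤ (ℤ.- k) i+k≤j)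
  where
  cancel : ∀ i k → i ℤ.+ k ℤ.- k ≡ i
  cancel = solve-∀

positives : List ℤ → List ℤ
positives = filter (λ a → +0 ℤ.<? a)

Maxima : ℕ → List ℤ → List ℤ → Set
Maxima t A M = ∀ a → (a ∈ M) ⇔ IsMaximal t A a

ProductFormula : ℕ → List ℤ → List ℤ → Set
ProductFormula t A M =
  ℚ.- prodℚ (map (positiveFactor (modulus t)) (positives A))
    ≡ prodℚ (map (maximalFactor (modulus t)) M)

modulus≡ : ∀ t → modulus t ≡ +[1+ 2 ℕ.* t ℕ.+ 1 ]
modulus≡ t = cong +_ (ℕP.+-suc (2 ℕ.* t) 1)

0<modulus : ∀ t → +0 ℤ.< modulus t
0<modulus t = subst (+0 ℤ.<_) (sym (modulus≡ t)) (ℤ.+<+ (ℕ.s≤s ℕ.z≤n))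

special<0 : ∀ t {a} → IsSpecialNeg t a → a ℤ.< +0
special<0 t (suc i , _ , _ , refl) = ℤ.-<+

0<special+modulus : ∀ t {a} → IsSpecialNeg t a → +0 ℤ.< a ℤ.+ modulus t
0<special+modulus t (i , _ , i≤n , refl)
  rewrite modulus≡ t | ℤP.-m+n≡n⊖m i (suc (2 ℕ.* t ℕ.+ 1)) | ℤP.≤-⊖ (ℕP.m≤n⇒m≤1+n i≤n) =
  ℤ.+<+ (ℕP.m<n⇒0<n∸m (ℕ.s≤s i≤n))

special⇔∈negRange : ∀ t {a} → IsSpecialNeg t a ⇔ a ∈ negRange (2 ℕ.* t ℕ.+ 1)
special⇔∈negRange t =
  mk⇔ (λ where (_ , 1≤i , i≤n , refl) → ∈-negRange⁺ _ 1≤i i≤n) (∈-negRange⁻ _)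

special? : ∀ t a → Dec (IsSpecialNeg t a)
special? t a = Dec.map (⇔.sym (special⇔∈negRange t)) (a ∈? negRange (2 ℕ.* t ℕ.+ 1))

maximal⇔special : ∀ {t A} → Compact t A → (∀ {a} → a ∈ A → ¬ (+0 ℤ.< a)) →
                  ∀ a → IsMaximal t A a ⇔ IsSpecialNeg t a
maximal⇔special {t} {A} compact nonpositive a = mk⇔ to from
  where
  open Compact compact
  to : IsMaximal t A a → IsSpecialNeg t a
  to (a∈ , _) with special? t a
  ... | yes special = special
  ... | no ¬special = ⊥-elim (nonpositive a∈ (ℤP.suc[i]≤j⇒i<j (proj₁ (others a a∈ ¬special))))
  from : IsSpecialNeg t a → IsMaximal t A a
  from special@(i , 1≤i , i≤n , refl) = negatives i 1≤i i≤n , λ b b∈ a<b a≡b →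
    nonpositive b∈ (ℤP.<-≤-trans (0<special+modulus t special) (congruent-gap _ a<b a≡b))

module LargestPositive {t : ℕ} {A : List ℤ} (compact : Compact t A) (x : ℕ) (X∈A : +[1+ x ] ∈ A)
           (top : ∀ {b} → b ∈ A → +0 ℤ.< b → b ℤ.≤ +[1+ x ]) where

  open Compact compact

  private
    X = +[1+ x ]
    m = modulus t
    n = 2 ℕ.* t ℕ.+ 1

    0<X : +0 ℤ.< X
    0<X = ℤ.+<+ (ℕ.s≤s ℕ.z≤n)

    m∤X : ¬ (m ∣ X)
    m∤X = proj₂ (others X X∈A (λ special → ℤP.<-asym (special<0 t special) 0<X))

    m∣m : m ∣ m
    m∣m = DS.∣⇒∣ᵤ (DS.∣-refl {m})

    X-m<X : X ℤ.- m ℤ.< X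
    X-m<X = i-j<i X (0<modulus t)

  X-m≢0 : X ℤ.- m ≢ +0
  X-m≢0 X-m≡0 = m∤X (subst (m ∣_) (sym (ℤP.i-j≡0⇒i≡j X m X-m≡0)) m∣m)

  X-m∈A : X ℤ.- m ∈ A
  X-m∈A with X-m≡ ← cong (λ k → X ℤ.- k) (modulus≡ t) | ℕP.<-cmp x n
  ... | tri< x<n _ _ = subst (_∈ A) (sym (trans X-m≡ (ℤP.⊖-< (ℕ.s≤s x<n))))
                             (negatives (n ℕ.∸ x) (ℕP.m<n⇒0<n∸m x<n) (ℕP.m∸n≤m n x))
  ... | tri≈ _ refl _ = ⊥-elim (m∤X (subst (m ∣_) (modulus≡ t) m∣m))
  ... | tri> _ _ n<x = downward (X ℤ.- m) X X-m<X 1≤X-m (x-k≡x X m) X∈A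
    where
    1≤X-m : + 1 ℤ.≤ X ℤ.- m
    1≤X-m = subst (+ 1 ℤ.≤_) (sym (trans X-m≡ (ℤP.⊖-≥ (ℕP.<⇒≤ (ℕ.s≤s n<x)))))
                  (ℤ.+≤+ (ℕP.m<n⇒0<n∸m n<x))

  X-maximal : IsMaximal t A X
  X-maximal = X∈A , λ b b∈ X<b _ → ℤP.<⇒≱ X<b (top b∈ (ℤP.<-trans 0<X X<b))

  X-m-nonmaximal : ¬ IsMaximal t A (X ℤ.- m)
  X-m-nonmaximal (_ , maximal) = maximal X X∈A X-m<X (x-k≡x X m)

  compact-∖ : Compact t (A ∖ X)
  compact-∖ = record
    { negatives = λ i 1≤i i≤n → ∈-∖⁺ (negatives i 1≤i i≤n)
                    (ℤP.<⇒≢ (ℤP.<-trans (special<0 t (i , 1≤i , i≤n , refl)) 0<X))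
    ; others    = λ a a∈ ¬special → others a (proj₁ (∈-∖⁻ A a∈)) ¬special
    ; downward  = λ a b a<b 1≤a a≡b b∈ → let b∈A = proj₁ (∈-∖⁻ A b∈) in
        ∈-∖⁺ (downward a b a<b 1≤a a≡b b∈A)
             (ℤP.<⇒≢ (ℤP.<-≤-trans a<b (top b∈A (ℤP.<-trans (ℤP.suc[i]≤j⇒i<j 1≤a) a<b))))
    }

  maxima-∖ : ∀ {M} → Maxima t A M → Maxima t (A ∖ X) (X ℤ.- m ∷ M ∖ X)
  maxima-∖ {M} maxima a = mk⇔ to from
    where
    X-m∈A∖X : X ℤ.- m ∈ A ∖ X
    X-m∈A∖X = ∈-∖⁺ X-m∈A (ℤP.<⇒≢ X-m<X)
    X-m+m≡X : X ℤ.- m ℤ.+ m ≡ X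
    X-m+m≡X = cancel X m
      where
      cancel : ∀ x m → x ℤ.- m ℤ.+ m ≡ x
      cancel = solve-∀
    to : a ∈ X ℤ.- m ∷ M ∖ X → IsMaximal t (A ∖ X) a
    to (here refl) = X-m∈A∖X , λ b b∈ X-m<b X-m≡b →
      let b∈A , b≢X = ∈-∖⁻ A b∈
          X≤b = subst (ℤ._≤ b) X-m+m≡X (congruent-gap _ X-m<b X-m≡b)
      in ℤP.<⇒≱ (ℤP.≤∧≢⇒< X≤b (b≢X ∘ sym)) (top b∈A (ℤP.<-≤-trans 0<X X≤b))
    to (there a∈) =
      let a∈M , a≢X = ∈-∖⁻ M a∈
          a∈A , maximal = Equivalence.to (maxima a) a∈M
      in ∈-∖⁺ a∈A a≢X , λ b b∈ → maximal b (proj₁ (∈-∖⁻ A b∈))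
    from : IsMaximal t (A ∖ X) a → a ∈ X ℤ.- m ∷ M ∖ X
    from (a∈ , maximal∖) with a ℤ.≟ X ℤ.- m
    ... | yes refl   = here refl
    ... | no  a≢X-m = there (∈-∖⁺ (Equivalence.from (maxima a) (proj₁ (∈-∖⁻ A a∈) , maximal))
                                   (proj₂ (∈-∖⁻ A a∈)))
      where
      -- X itself is no obstruction: a congruence a ≡ X would give a ≡ X - m with a < X - m.
      maximal : ∀ b → b ∈ A → a ℤ.< b → ¬ (a ≡ b [mod m ])
      maximal b b∈ a<b a≡b with b ℤ.≟ X
      ... | no  b≢X = maximal∖ b (∈-∖⁺ b∈ b≢X) a<b a≡b
      ... | yes refl = maximal∖ (X ℤ.- m) X-m∈A∖X
                         (ℤP.≤∧≢⇒< (i+k≤j⇒i≤j-k m (congruent-gap _ a<b a≡b)) a≢X-m)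
                         (≡[mod]-shift {a} {X} {m} a≡b)

  X∈maxima : ∀ {M} → Maxima t A M → X ∈ M
  X∈maxima maxima = Equivalence.from (maxima X) X-maximal

  maxima-∖-unique : ∀ {M} → Maxima t A M → Unique M → Unique (X ℤ.- m ∷ M ∖ X)
  maxima-∖-unique {M} maxima M! =
    All.tabulate (λ b∈ X-m≡b → X-m-nonmaximal (Equivalence.to (maxima _)
                                  (subst (_∈ M) (sym X-m≡b) (proj₁ (∈-∖⁻ M b∈)))))
    ∷ ∖-unique M!

  positives-↭ : Unique A → positives A ↭ X ∷ positives (A ∖ X)
  positives-↭ A! = ↭-trans (↭ₚ.filter-↭ (λ a → +0 ℤ.<? a) (↭-∷-∖ A! X∈A))
                              (↭-reflexive (List.filter-accept (λ a → +0 ℤ.<? a) {xs = A ∖ X} 0<X))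

  product-step : ∀ {M} → Unique A → Unique M → Maxima t A M →
    ProductFormula t (A ∖ X) (X ℤ.- m ∷ M ∖ X) → ProductFormula t A M
  product-step {M} A! M! maxima IH = begin
    ℚ.- prodℚ (map f (positives A))
      ≡⟨ cong ℚ.-_ (prodℚ-↭ (↭ₚ.map⁺ f (positives-↭ A!))) ⟩
    ℚ.- (f X ℚ.* prodℚ (map f (positives (A ∖ X))))
      ≡⟨ ℚP.neg-distribʳ-* (f X) _ ⟩
    f X ℚ.* ℚ.- prodℚ (map f (positives (A ∖ X)))
      ≡⟨ cong (f X ℚ.*_) IH ⟩
    f X ℚ.* (g (X ℤ.- m) ℚ.* prodℚ (map g (M ∖ X)))
      ≡⟨ ℚP.*-assoc (f X) _ _ ⟨
    f X ℚ.* g (X ℤ.- m) ℚ.* prodℚ (map g (M ∖ X))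
      ≡⟨ cong (ℚ._* prodℚ (map g (M ∖ X))) (positiveFactor-telescopes x m X-m≢0) ⟩
    g X ℚ.* prodℚ (map g (M ∖ X))
      ≡⟨ prodℚ-map-∖ g M! (X∈maxima maxima) ⟨
    prodℚ (map g M)
      ∎
    where
    open ≡-Reasoning
    f = positiveFactor (modulus t)
    g = maximalFactor (modulus t)

product-base : ∀ {t A M} → Compact t A → Unique M → Maxima t A M → positives A ≡ [] →
               ProductFormula t A M
product-base {t} {A} {M} compact M! maxima none rewrite none = sym (begin
  prodℚ (map (maximalFactor (modulus t)) M)
    ≡⟨ prodℚ-↭ (↭ₚ.map⁺ (maximalFactor (modulus t)) M↭negRange) ⟩
  prodℚ (map (maximalFactor (modulus t)) (negRange n))
    ≡⟨ cong (λ k → prodℚ (map (maximalFactor k) (negRange n))) (modulus≡ t) ⟩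
  prodℚ (map (maximalFactor +[1+ n ]) (negRange n))
    ≡⟨ prodℚ-negRange n ⟩
  ratio (ℤ.-1ℤ ℤ.^ n) (+ 1)
    ≡⟨ cong (λ k → ratio k (+ 1)) (-1^odd t) ⟩
  ℚ.- ℚ.1ℚ
    ∎)
  where
  open ≡-Reasoning
  n = 2 ℕ.* t ℕ.+ 1
  nonpositive : ∀ {a} → a ∈ A → ¬ (+0 ℤ.< a)
  nonpositive a∈ 0<a with () ← subst (_ ∈_) none (∈-filter⁺ (λ a → +0 ℤ.<? a) a∈ 0<a)
  M↭negRange : M ↭ negRange n
  M↭negRange = unique-⇔⇒↭ M! (negRange-unique n) λ {a} →
    ⇔.trans (maxima a) (⇔.trans (maximal⇔special compact nonpositive a) (special⇔∈negRange t))

product-identity : ∀ t n A → length (positives A) ≡ n → Unique A → Compact t A →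
  ∀ M → Unique M → Maxima t A M → ProductFormula t A M
product-identity t zero A len A! compact M M! maxima = product-base compact M! maxima (length≡0⇒≡[] len)
product-identity t (suc n) A len A! compact M M! maxima
  with X , X∈ , X-top ← maximum {positives A} (λ none → case trans (sym len) (cong length none) of λ ())
  with X∈A , ℤ.+<+ {n = suc x} _ ← ∈-filter⁻ (λ a → +0 ℤ.<? a) {xs = A} X∈ =
  product-step A! M! maxima
    (product-identity t n (A ∖ X) len∖ (∖-unique A!) compact-∖
                      _ (maxima-∖-unique maxima M!) (maxima-∖ maxima))
  where
  top : ∀ {b} → b ∈ A → +0 ℤ.< b → b ℤ.≤ X
  top b∈ 0<b = All.lookup X-top (∈-filter⁺ (λ a → +0 ℤ.<? a) b∈ 0<b)
  open LargestPositive compact x X∈A top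
  len∖ : length (positives (A ∖ X)) ≡ n
  len∖ = ℕP.suc-injective (trans (sym (↭ₚ.↭-length (positives-↭ A!))) len)

lemma3p5 : (t : ℕ) → 2 ℕ.≤ t → (A : List ℤ) → Unique A → Compact t A →
           (M : List ℤ) → Unique M → (∀ a → (a ∈ M) ⇔ IsMaximal t A a) →
           ℚ.- prodℚ (map (λ a → ℚ.1ℚ ℚ.- (ratio (modulus t) a ℚ.* ratio (modulus t) a))
                          (filter (λ a → +0 ℤ.<? a) A))
             ≡ prodℚ (map (λ a → ratio (a ℤ.+ modulus t) a) M)
lemma3p5 t _ A A! compact M M! maxima = product-identity t _ A refl A! compact M M! maxima
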